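{- For any set of rule schemes $\mathcal{R}\subseteq\{N,H,P,F,wF\}$: if $\mathbf{STL}(\mathcal{R})\vdash\Gamma\Rightarrow A$ then $\mathbf{ST}(\mathcal{R})\vDash\Gamma\Rightarrow A$. In particular, if $i\mathbf{STL}(\mathcal{R})\vdash\Gamma\Rightarrow A$ then $i\mathbf{ST}(\mathcal{R})\vDash\Gamma\Rightarrow A$.
   Context: Language $\mathcal{L}_\nabla$: formulas built from propositional atoms and constants $\top,\bot,1$ by binary $\wedge,\vee,\otimes,\to$ and unary $\nabla$. A sequent is $\Gamma\Rightarrow A$ with $\Gamma$ a finite (possibly empty) sequence of formulas; $\nabla\Gamma$ applies $\nabla$ to each member. The system $\mathbf{STL}$ has: axioms $A\Rightarrow A$; $\Rightarrow 1$; $\nabla 1\Rightarrow 1$; $\Gamma\Rightarrow\top$; $\Gamma,\bot,\Sigma\Rightarrow A$. Cut: from $\Gamma\Rightarrow A$ and $\Pi,A,\Sigma\Rightarrow B$ infer $\Pi,\Gamma,\Sigma\Rightarrow B$. $L\wedge$: from $\Gamma,A,\Sigma\Rightarrow C$ infer $\Gamma,A\wedge B,\Sigma\Rightarrow C$ and $\Gamma,B\wedge A,\Sigma\Rightarrow C$. $R\wedge$: from $\Gamma\Rightarrow A$, $\Gamma\Rightarrow B$ infer $\Gamma\Rightarrow A\wedge B$. $L\vee$: from $\Gamma,A,\Sigma\Rightarrow C$ and $\Gamma,B,\Sigma\Rightarrow C$ infer $\Gamma,A\vee B,\Sigma\Rightarrow C$. $R\vee$: from $\Gamma\Rightarrow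 A$ infer $\Gamma\Rightarrow A\vee B$ and $\Gamma\Rightarrow B\vee A$. $L1$: from $\Gamma,\Sigma\Rightarrow A$ infer $\Gamma,1,\Sigma\Rightarrow A$. $L\otimes$: from $\Gamma,A,B,\Sigma\Rightarrow C$ infer $\Gamma,A\otimes B,\Sigma\Rightarrow C$. $R\otimes$: from $\Gamma\Rightarrow A$, $\Sigma\Rightarrow B$ infer $\Gamma,\Sigma\Rightarrow A\otimes B$. Rule $\nabla$: from $A\Rightarrow B$ infer $\nabla A\Rightarrow\nabla B$. Oplax: from $\nabla A,\nabla B\Rightarrow C$ infer $\nabla(A\otimes B)\Rightarrow C$. $L\to$: from $\Gamma\Rightarrow A$ and $\Pi,B,\Sigma\Rightarrow C$ infer $\Pi,\Gamma,\nabla(A\to B),\Sigma\Rightarrow C$. $R\to$: from $A,\nabla\Gamma\Rightarrow B$ infer $\Gamma\Rightarrow A\to B$. Rule schemes: $(N)$ from $\Gamma\Rightarrow A$ infer $\nabla\Gamma\Rightarrow\nabla A$; $(P)$ from $\Gamma\Rightarrow\nabla A$ infer $\Gamma\Rightarrow A$; $(F)$ from $\Gamma\Rightarrow A$ infer $\Gamma\Rightarrow\nabla A$; $(wF)$ from $\nabla A\Rightarrow\bot$ infer $A\Rightarrow\bot$; $(H)$ from $\Gamma,A_1\to B_1,\dots,A_n\to B_n\Rightarrow C$ infer $\nabla\Gamma,\nabla A_1\to\nabla B_1,\dots,\nabla A_n\to\nabla B_n\Rightarrow\nabla C$ ($n\geq 0$). Structural rules: weakening (from $\Gamma,\Sigma\Rightarrow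 B$ infer $\Gamma,A,\Sigma\Rightarrow B$), contraction (from $\Gamma,A,A,\Sigma\Rightarrow B$ infer $\Gamma,A,\Sigma\Rightarrow B$), exchange (from $\Gamma,A,B,\Sigma\Rightarrow C$ infer $\Gamma,B,A,\Sigma\Rightarrow C$). $\mathbf{STL}(\mathcal{R})$ is $\mathbf{STL}$ plus the schemes in $\mathcal{R}$; $i\mathbf{STL}(\mathcal{R})$ is $\mathbf{STL}(\mathcal{R})$ plus the structural rules. Semantics: a quantale is a monoidal poset (poset with monoid $(\otimes,e)$, $\otimes$ monotone) with all joins and $\otimes$ distributing over arbitrary joins on both sides; a locale is a quantale whose multiplication is binary meet and unit the top. A non-commutative spacetime is $(\mathscr{X},\nabla)$ with $\mathscr{X}$ a quantale and $\nabla$ join preserving with $\nabla e\leq e$, $\nabla(a\otimes b)\leq\nabla a\otimes\nabla b$; a spacetime is one with $\mathscr{X}$ a locale. Its implication $\to_{\mathcal{S}}$ is given by $a\otimes\nabla b\leq c$ iff $b\leq a\to_{\mathcal{S}}c$. A valuation $V$ maps atoms to $\mathscr{X}$ and extends by $V(1)=e$, $V(\bot)=0$ (bottom), $V(\top)=$ top, $V(A\wedge B)=V(A)\wedge V(B)$, $V(A\vee B)=V(A)\vee V(B)$, $V(A\otimes B)=V(A)\otimes V(B)$, $V(\nabla A)=\nabla V(A)$, $V(A\to B)=V(A)\to_{\mathcal{S}}V(B)$. $(\mathcal{S},V)\vDash\Gamma\Rightarrow A$ means $V(\gamma_1)\otimes\cdots\otimes V(\gamma_n)\leq V(A)$ for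 $\Gamma=\gamma_1,\dots,\gamma_n$ (empty product $=e$); $\mathcal{S}\vDash\Gamma\Rightarrow A$ means this for all $V$; for a class $\mathcal{C}$, $\mathcal{C}\vDash\Gamma\Rightarrow A$ means $\mathcal{S}\vDash\Gamma\Rightarrow A$ for all $\mathcal{S}\in\mathcal{C}$. Conditions on $(\mathscr{X},\nabla)$: $(N)$ $\nabla e=e$ and $\nabla(a\otimes b)=\nabla a\otimes\nabla b$; $(H)$ $\nabla$ preserves all the structure (unit, multiplication, meets, joins) including the implication $\to_{\mathcal{S}}$; $(P)$ $\nabla a\leq a$ for all $a$; $(F)$ $a\leq\nabla a$ for all $a$; $(wF)$ $\nabla a=0$ implies $a=0$. $\mathbf{ST}(\mathcal{R})$ is the class of non-commutative spacetimes satisfying all conditions in $\mathcal{R}$, $i\mathbf{ST}(\mathcal{R})$ the class of spacetimes satisfying them. -}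

module Defs where

open import Level using (Level; _⊔_; suc; Lift)
open import Data.Nat using (ℕ)
open import Data.Bool using (Bool; true; false; T)
open import Data.List using (List; []; _∷_; _++_; map)
open import Data.Product using (Σ; _×_; _,_; proj₁)
open import Relation.Binary.Bundles using (Poset)
open import Algebra.Core using (Op₂)

infixr 30 _⊗'_
infixr 25 _∧'_ _∨'_
infixr 20 _⇒'_

data Fm : Set where
  var  : ℕ → Fm
  ⊤'   : Fm
  ⊥'   : Fm
  𝟙'   : Fm
  _∧'_ : Fm → Fm → Fm
  _∨'_ : Fm → Fm → Fm
  _⊗'_ : Fm → Fm → Fm
  _⇒'_ : Fm → Fm → Fm
  ∇'   : Fm → Fm

Ctx : Set
Ctx = List Fm

∇Ctx : Ctx → Ctx
∇Ctx = map ∇'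

data Scheme : Set where
  N H P F wF : Scheme

imps : List (Fm × Fm) → Ctx
imps [] = []
imps ((A , B) ∷ ps) = (A ⇒' B) ∷ imps ps

∇imps : List (Fm × Fm) → Ctx
∇imps [] = []
∇imps ((A , B) ∷ ps) = (∇' A ⇒' ∇' B) ∷ ∇imps ps

-- Derivability in STL(R) (st = false) and iSTL(R) (st = true).
-- R : Scheme → Bool is the set of added rule schemes;
-- st says whether weakening, contraction, exchange are available.

infix 4 Der

data Der (R : Scheme → Bool) (st : Bool) : Ctx → Fm → Set where
  ax    : ∀ A → Der R st (A ∷ []) A
  ax1   : Der R st [] 𝟙'
  ax∇1  : Der R st (∇' 𝟙' ∷ []) 𝟙'
  ax⊤   : ∀ Γ → Der R st Γ ⊤'
  ax⊥   : ∀ Γ Σ' A → Der R st (Γ ++ ⊥' ∷ Σ') A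
  cut   : ∀ {Γ Π Σ' A B} → Der R st Γ A → Der R st (Π ++ A ∷ Σ') B →
          Der R st (Π ++ Γ ++ Σ') B
  L∧₁   : ∀ {Γ Σ' A B C} → Der R st (Γ ++ A ∷ Σ') C → Der R st (Γ ++ (A ∧' B) ∷ Σ') C
  L∧₂   : ∀ {Γ Σ' A B C} → Der R st (Γ ++ A ∷ Σ') C → Der R st (Γ ++ (B ∧' A) ∷ Σ') C
  R∧    : ∀ {Γ A B} → Der R st Γ A → Der R st Γ B → Der R st Γ (A ∧' B)
  L∨    : ∀ {Γ Σ' A B C} → Der R st (Γ ++ A ∷ Σ') C → Der R st (Γ ++ B ∷ Σ') C →
          Der R st (Γ ++ (A ∨' B) ∷ Σ') C
  R∨₁   : ∀ {Γ A B} → Der R st Γ A → Der R st Γ (A ∨' B)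
  R∨₂   : ∀ {Γ A B} → Der R st Γ A → Der R st Γ (B ∨' A)
  L1    : ∀ {Γ Σ' A} → Der R st (Γ ++ Σ') A → Der R st (Γ ++ 𝟙' ∷ Σ') A
  L⊗    : ∀ {Γ Σ' A B C} → Der R st (Γ ++ A ∷ B ∷ Σ') C → Der R st (Γ ++ (A ⊗' B) ∷ Σ') C
  R⊗    : ∀ {Γ Σ' A B} → Der R st Γ A → Der R st Σ' B → Der R st (Γ ++ Σ') (A ⊗' B)
  r∇    : ∀ {A B} → Der R st (A ∷ []) B → Der R st (∇' A ∷ []) (∇' B)
  oplax : ∀ {A B C} → Der R st (∇' A ∷ ∇' B ∷ []) C → Der R st (∇' (A ⊗' B) ∷ []) C
  L⇒    : ∀ {Γ Π Σ' A B C} → Der R st Γ A → Der R st (Π ++ B ∷ Σ') C →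
          Der R st (Π ++ Γ ++ ∇' (A ⇒' B) ∷ Σ') C
  R⇒    : ∀ {Γ A B} → Der R st (A ∷ ∇Ctx Γ) B → Der R st Γ (A ⇒' B)
  rN    : T (R N) → ∀ {Γ A} → Der R st Γ A → Der R st (∇Ctx Γ) (∇' A)
  rP    : T (R P) → ∀ {Γ A} → Der R st Γ (∇' A) → Der R st Γ A
  rF    : T (R F) → ∀ {Γ A} → Der R st Γ A → Der R st Γ (∇' A)
  rwF   : T (R wF) → ∀ {A} → Der R st (∇' A ∷ []) ⊥' → Der R st (A ∷ []) ⊥'
  rH    : T (R H) → ∀ {Γ ps C} → Der R st (Γ ++ imps ps) C →
          Der R st (∇Ctx Γ ++ ∇imps ps) (∇' C)
  wk    : T st → ∀ {Γ Σ' A B} → Der R st (Γ ++ Σ') B → Der R st (Γ ++ A ∷ Σ') B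
  ctr   : T st → ∀ {Γ Σ' A B} → Der R st (Γ ++ A ∷ A ∷ Σ') B → Der R st (Γ ++ A ∷ Σ') B
  exch  : T st → ∀ {Γ Σ' A B C} → Der R st (Γ ++ A ∷ B ∷ Σ') C →
          Der R st (Γ ++ B ∷ A ∷ Σ') C

STL⊢ : (Scheme → Bool) → Ctx → Fm → Set
STL⊢ R = Der R false

iSTL⊢ : (Scheme → Bool) → Ctx → Fm → Set
iSTL⊢ R = Der R true

-- Arbitrary joins are joins of families indexed by types of
-- level c ⊔ ℓ₁ ⊔ ℓ₂ (enough to cover all subsets of the carrier).
-- Finite meets/joins are included as fields with their universal
-- properties (they are uniquely determined by the complete order).

record Quantale (c ℓ₁ ℓ₂ : Level) : Set (suc (c ⊔ ℓ₁ ⊔ ℓ₂)) where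
  infixr 30 _⊗_
  infixr 25 _∧_ _∨_
  field
    poset : Poset c ℓ₁ ℓ₂
  open Poset poset public
  field
    _⊗_ : Op₂ Carrier
    e   : Carrier
    ⊗-assoc     : ∀ x y z → (x ⊗ y) ⊗ z ≈ x ⊗ (y ⊗ z)
    ⊗-identityˡ : ∀ x → e ⊗ x ≈ x
    ⊗-identityʳ : ∀ x → x ⊗ e ≈ x
    ⊗-mono      : ∀ {x x' y y'} → x ≤ x' → y ≤ y' → x ⊗ y ≤ x' ⊗ y'
    ⋁        : {I : Set (c ⊔ ℓ₁ ⊔ ℓ₂)} → (I → Carrier) → Carrier
    ⋁-upper  : ∀ {I} (f : I → Carrier) (i : I) → f i ≤ ⋁ f
    ⋁-least  : ∀ {I} (f : I → Carrier) {x} → (∀ i → f i ≤ x) → ⋁ f ≤ x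
    ⋁-distribˡ : ∀ x {I} (f : I → Carrier) → x ⊗ ⋁ f ≈ ⋁ (λ i → x ⊗ f i)
    ⋁-distribʳ : ∀ x {I} (f : I → Carrier) → ⋁ f ⊗ x ≈ ⋁ (λ i → f i ⊗ x)
    _∧_ : Op₂ Carrier
    ∧-lb₁ : ∀ x y → x ∧ y ≤ x
    ∧-lb₂ : ∀ x y → x ∧ y ≤ y
    ∧-glb : ∀ {x y z} → z ≤ x → z ≤ y → z ≤ x ∧ y
    _∨_ : Op₂ Carrier
    ∨-ub₁ : ∀ x y → x ≤ x ∨ y
    ∨-ub₂ : ∀ x y → y ≤ x ∨ y
    ∨-lub : ∀ {x y z} → x ≤ z → y ≤ z → x ∨ y ≤ z
    top : Carrier
    top-max : ∀ x → x ≤ top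
    bot : Carrier
    bot-min : ∀ x → bot ≤ x

IsLocale : ∀ {c ℓ₁ ℓ₂} → Quantale c ℓ₁ ℓ₂ → Set (c ⊔ ℓ₁)
IsLocale Q = (∀ x y → x ⊗ y ≈ x ∧ y) × (e ≈ top)
  where open Quantale Q

record NCSpacetime (c ℓ₁ ℓ₂ : Level) : Set (suc (c ⊔ ℓ₁ ⊔ ℓ₂)) where
  field
    quantale : Quantale c ℓ₁ ℓ₂
  open Quantale quantale public
  field
    ∇       : Carrier → Carrier
    ∇-cong  : ∀ {x y} → x ≈ y → ∇ x ≈ ∇ y
    ∇-⋁     : ∀ {I} (f : I → Carrier) → ∇ (⋁ f) ≈ ⋁ (λ i → ∇ (f i))
    ∇-e     : ∇ e ≤ e
    ∇-⊗     : ∀ x y → ∇ (x ⊗ y) ≤ ∇ x ⊗ ∇ y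

  -- the implication: x ⊗ ∇ y ≤ z iff y ≤ x ⇨ z  (its right adjoint)
  infixr 20 _⇨_
  _⇨_ : Carrier → Carrier → Carrier
  x ⇨ z = ⋁ {I = Lift ℓ₁ (Σ Carrier (λ y → x ⊗ ∇ y ≤ z))}
             (λ { (Level.lift (y , _)) → y })

Cond : ∀ {c ℓ₁ ℓ₂} → NCSpacetime c ℓ₁ ℓ₂ → Scheme → Set (c ⊔ ℓ₁ ⊔ ℓ₂)
Cond {c} {ℓ₁} {ℓ₂} S N  = Lift ℓ₂ ((∇ e ≈ e) × (∀ x y → ∇ (x ⊗ y) ≈ ∇ x ⊗ ∇ y))
  where open NCSpacetime S
Cond {c} {ℓ₁} {ℓ₂} S H  = Lift ℓ₂ ((∇ e ≈ e) × (∀ x y → ∇ (x ⊗ y) ≈ ∇ x ⊗ ∇ y)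
          × (∇ top ≈ top) × (∀ x y → ∇ (x ∧ y) ≈ ∇ x ∧ ∇ y)
          × (∀ x y → ∇ (x ⇨ y) ≈ (∇ x ⇨ ∇ y)))
  where open NCSpacetime S
Cond {c} {ℓ₁} {ℓ₂} S P  = Lift ℓ₁ (∀ x → ∇ x ≤ x)
  where open NCSpacetime S
Cond {c} {ℓ₁} {ℓ₂} S F  = Lift ℓ₁ (∀ x → x ≤ ∇ x)
  where open NCSpacetime S
Cond {c} {ℓ₁} {ℓ₂} S wF = Lift ℓ₂ (∀ x → ∇ x ≈ bot → x ≈ bot)
  where open NCSpacetime S

InST : ∀ {c ℓ₁ ℓ₂} → (Scheme → Bool) → NCSpacetime c ℓ₁ ℓ₂ → Set (c ⊔ ℓ₁ ⊔ ℓ₂)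
InST R S = ∀ s → T (R s) → Cond S s

IniST : ∀ {c ℓ₁ ℓ₂} → (Scheme → Bool) → NCSpacetime c ℓ₁ ℓ₂ → Set (c ⊔ ℓ₁ ⊔ ℓ₂)
IniST R S = IsLocale (NCSpacetime.quantale S) × InST R S

module _ {c ℓ₁ ℓ₂} (S : NCSpacetime c ℓ₁ ℓ₂) where
  open NCSpacetime S

  ⟦_⟧ : Fm → (ℕ → Carrier) → Carrier
  ⟦ var p ⟧ V = V p
  ⟦ ⊤' ⟧ V = top
  ⟦ ⊥' ⟧ V = bot
  ⟦ 𝟙' ⟧ V = e
  ⟦ A ∧' B ⟧ V = ⟦ A ⟧ V ∧ ⟦ B ⟧ V
  ⟦ A ∨' B ⟧ V = ⟦ A ⟧ V ∨ ⟦ B ⟧ V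
  ⟦ A ⊗' B ⟧ V = ⟦ A ⟧ V ⊗ ⟦ B ⟧ V
  ⟦ A ⇒' B ⟧ V = ⟦ A ⟧ V ⇨ ⟦ B ⟧ V
  ⟦ ∇' A ⟧ V = ∇ (⟦ A ⟧ V)

  ⟦_⟧ctx : Ctx → (ℕ → Carrier) → Carrier
  ⟦ [] ⟧ctx V = e
  ⟦ A ∷ [] ⟧ctx V = ⟦ A ⟧ V
  ⟦ A ∷ B ∷ Γ ⟧ctx V = ⟦ A ⟧ V ⊗ ⟦ B ∷ Γ ⟧ctx V

  Valid : Ctx → Fm → Set (c ⊔ ℓ₂)
  Valid Γ A = ∀ (V : ℕ → Carrier) → ⟦ Γ ⟧ctx V ≤ ⟦ A ⟧ V

module Submission where

-- A context Γ is read
-- as the ordered product  prod Γ = ⟦γ₁⟧ ⊗ (⋯ ⊗ (⟦γₙ⟧ ⊗ e)),  and every rule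
-- is shown to preserve  prod Γ ≤ ⟦A⟧.

open import Defs
open import Level using (Level; _⊔_; Lift; lift; lower)
open import Data.Bool using (Bool; true; false; T)
open import Data.Empty using (⊥)
open import Data.Nat using (ℕ)
open import Data.List using (List; []; _∷_; _++_; map)
open import Data.Product using (_×_; _,_; proj₁) renaming (Σ to Σ')
open import Function using (_∘_)
open import Relation.Binary.PropositionalEquality as ≡ using (_≡_)
import Relation.Binary.Reasoning.PartialOrder as ≤-Reasoning

module QuantaleFacts {c ℓ₁ ℓ₂} (Q : Quantale c ℓ₁ ℓ₂) where
  open Quantale Q
  open ≤-Reasoning poset

  ⊗-cong : ∀ {x x' y y'} → x ≈ x' → y ≈ y' → x ⊗ y ≈ x' ⊗ y'
  ⊗-cong p q = antisym (⊗-mono (reflexive p) (reflexive q))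
                       (⊗-mono (reflexive (Eq.sym p)) (reflexive (Eq.sym q)))

  ⊗-monoˡ : ∀ {x x'} y → x ≤ x' → x ⊗ y ≤ x' ⊗ y
  ⊗-monoˡ y p = ⊗-mono p refl

  ⊗-monoʳ : ∀ x {y y'} → y ≤ y' → x ⊗ y ≤ x ⊗ y'
  ⊗-monoʳ x p = ⊗-mono refl p

  ⟨_,_⟩ : Carrier → Carrier → Lift (c ⊔ ℓ₁ ⊔ ℓ₂) Bool → Carrier
  ⟨ x , y ⟩ (lift true)  = x
  ⟨ x , y ⟩ (lift false) = y

  ∨≤⋁⟨,⟩ : ∀ x y → x ∨ y ≤ ⋁ ⟨ x , y ⟩
  ∨≤⋁⟨,⟩ x y = ∨-lub (⋁-upper ⟨ x , y ⟩ (lift true)) (⋁-upper ⟨ x , y ⟩ (lift false))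

  -- If x ≤ y then the join of {x, y} is y; used to get monotonicity of
  -- join-preserving maps.
  ⋁⟨,⟩-absorb : ∀ {x y} → x ≤ y → ⋁ ⟨ x , y ⟩ ≈ y
  ⋁⟨,⟩-absorb {x} {y} x≤y =
    antisym (⋁-least ⟨ x , y ⟩ λ { (lift true) → x≤y ; (lift false) → refl })
            (⋁-upper ⟨ x , y ⟩ (lift false))

  ⊗-distrib-∨ : ∀ x a b y → x ⊗ ((a ∨ b) ⊗ y) ≤ (x ⊗ (a ⊗ y)) ∨ (x ⊗ (b ⊗ y))
  ⊗-distrib-∨ x a b y = begin
    x ⊗ ((a ∨ b) ⊗ y)                  ≤⟨ ⊗-monoʳ x (⊗-monoˡ y (∨≤⋁⟨,⟩ a b)) ⟩
    x ⊗ (⋁ ⟨ a , b ⟩ ⊗ y)              ≈⟨ ⊗-cong Eq.refl (⋁-distribʳ y ⟨ a , b ⟩) ⟩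
    x ⊗ ⋁ (λ i → ⟨ a , b ⟩ i ⊗ y)      ≈⟨ ⋁-distribˡ x _ ⟩
    ⋁ (λ i → x ⊗ (⟨ a , b ⟩ i ⊗ y))    ≤⟨ ⋁-least _ (λ { (lift true)  → ∨-ub₁ _ _
                                                     ; (lift false) → ∨-ub₂ _ _ }) ⟩
    (x ⊗ (a ⊗ y)) ∨ (x ⊗ (b ⊗ y))      ∎

  -- Bottom is the empty join, so it annihilates ⊗ on both sides.
  private
    none : Lift (c ⊔ ℓ₁ ⊔ ℓ₂) ⊥ → Carrier
    none ()

  ⊗-zeroˡ : ∀ x → bot ⊗ x ≤ bot
  ⊗-zeroˡ x = begin
    bot ⊗ x               ≤⟨ ⊗-monoˡ x (bot-min (⋁ none)) ⟩
    ⋁ none ⊗ x            ≈⟨ ⋁-distribʳ x none ⟩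
    ⋁ (λ i → none i ⊗ x)  ≤⟨ ⋁-least _ (λ ()) ⟩
    bot                   ∎

  ⊗-zeroʳ : ∀ x → x ⊗ bot ≤ bot
  ⊗-zeroʳ x = begin
    x ⊗ bot               ≤⟨ ⊗-monoʳ x (bot-min (⋁ none)) ⟩
    x ⊗ ⋁ none            ≈⟨ ⋁-distribˡ x none ⟩
    ⋁ (λ i → x ⊗ none i)  ≤⟨ ⋁-least _ (λ ()) ⟩
    bot                   ∎

  prod : ∀ {a} {X : Set a} → (X → Carrier) → List X → Carrier
  prod f []      = e
  prod f (x ∷ Γ) = f x ⊗ prod f Γ

  module ListProduct {a} {X : Set a} (f : X → Carrier) where

    prod-[_] : ∀ x → prod f (x ∷ []) ≈ f x
    prod-[ x ] = ⊗-identityʳ (f x)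

    ≤-singleton : ∀ {y} x → y ≤ f x → y ≤ prod f (x ∷ [])
    ≤-singleton x y≤fx = trans y≤fx (reflexive (Eq.sym prod-[ x ]))

    singleton-≤ : ∀ {y} x → prod f (x ∷ []) ≤ y → f x ≤ y
    singleton-≤ x [x]≤y = trans (reflexive (Eq.sym prod-[ x ])) [x]≤y

    prod-++ : ∀ Γ Δ → prod f (Γ ++ Δ) ≈ prod f Γ ⊗ prod f Δ
    prod-++ []      Δ = Eq.sym (⊗-identityˡ (prod f Δ))
    prod-++ (x ∷ Γ) Δ = begin-equality
      f x ⊗ prod f (Γ ++ Δ)          ≈⟨ ⊗-cong Eq.refl (prod-++ Γ Δ) ⟩
      f x ⊗ (prod f Γ ⊗ prod f Δ)    ≈⟨ ⊗-assoc (f x) (prod f Γ) (prod f Δ) ⟨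
      (f x ⊗ prod f Γ) ⊗ prod f Δ    ∎

    prod-frame : ∀ Γ Ξ Σ → prod f (Γ ++ Ξ ++ Σ) ≈ prod f Γ ⊗ (prod f Ξ ⊗ prod f Σ)
    prod-frame Γ Ξ Σ = Eq.trans (prod-++ Γ (Ξ ++ Σ)) (⊗-cong Eq.refl (prod-++ Ξ Σ))

    replace : ∀ Γ Ξ Ξ' Σ → prod f Ξ ≤ prod f Ξ' → prod f (Γ ++ Ξ ++ Σ) ≤ prod f (Γ ++ Ξ' ++ Σ)
    replace Γ Ξ Ξ' Σ Ξ≤Ξ' = begin
      prod f (Γ ++ Ξ ++ Σ)                   ≈⟨ prod-frame Γ Ξ Σ ⟩
      prod f Γ ⊗ (prod f Ξ ⊗ prod f Σ)       ≤⟨ ⊗-monoʳ (prod f Γ) (⊗-monoˡ (prod f Σ) Ξ≤Ξ') ⟩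
      prod f Γ ⊗ (prod f Ξ' ⊗ prod f Σ)      ≈⟨ prod-frame Γ Ξ' Σ ⟨
      prod f (Γ ++ Ξ' ++ Σ)                  ∎

    replace₁ : ∀ Γ Σ {x y} → f x ≤ f y → prod f (Γ ++ x ∷ Σ) ≤ prod f (Γ ++ y ∷ Σ)
    replace₁ Γ Σ {x} {y} x≤y = replace Γ (x ∷ []) (y ∷ []) Σ (⊗-monoˡ e x≤y)

    bot-in-context : ∀ Γ Σ {x} → f x ≤ bot → prod f (Γ ++ x ∷ Σ) ≤ bot
    bot-in-context Γ Σ {x} x≤bot = begin
      prod f (Γ ++ x ∷ Σ)             ≈⟨ prod-++ Γ (x ∷ Σ) ⟩
      prod f Γ ⊗ (f x ⊗ prod f Σ)     ≤⟨ ⊗-monoʳ (prod f Γ) (⊗-monoˡ (prod f Σ) x≤bot) ⟩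
      prod f Γ ⊗ (bot ⊗ prod f Σ)     ≤⟨ ⊗-monoʳ (prod f Γ) (⊗-zeroˡ (prod f Σ)) ⟩
      prod f Γ ⊗ bot                  ≤⟨ ⊗-zeroʳ (prod f Γ) ⟩
      bot                             ∎

  prod-map : ∀ {a b} {X : Set a} {Y : Set b} (f : Y → Carrier) (g : X → Y) Γ →
             prod f (map g Γ) ≡ prod (f ∘ g) Γ
  prod-map f g []      = ≡.refl
  prod-map f g (x ∷ Γ) = ≡.cong (f (g x) ⊗_) (prod-map f g Γ)

-- In a locale ⊗ is the meet, so it is idempotent, commutative and below
-- each factor: exactly what weakening, contraction and exchange need.
module LocaleFacts {c ℓ₁ ℓ₂} (Q : Quantale c ℓ₁ ℓ₂) (locale : IsLocale Q) where
  open Quantale Q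
  open QuantaleFacts Q using (⊗-monoʳ)

  private
    ⊗≈∧ = proj₁ locale

  ⊗-projˡ : ∀ x y → x ⊗ y ≤ x
  ⊗-projˡ x y = trans (reflexive (⊗≈∧ x y)) (∧-lb₁ x y)

  ⊗-projʳ : ∀ x y → x ⊗ y ≤ y
  ⊗-projʳ x y = trans (reflexive (⊗≈∧ x y)) (∧-lb₂ x y)

  ⊗-pair : ∀ {x y z} → z ≤ x → z ≤ y → z ≤ x ⊗ y
  ⊗-pair z≤x z≤y = trans (∧-glb z≤x z≤y) (reflexive (Eq.sym (⊗≈∧ _ _)))

  ⊗-contract : ∀ x y → x ⊗ y ≤ x ⊗ (x ⊗ y)
  ⊗-contract x y = ⊗-pair (⊗-projˡ x y) refl

  ⊗-exchange : ∀ x y z → x ⊗ (y ⊗ z) ≤ y ⊗ (x ⊗ z)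
  ⊗-exchange x y z = ⊗-pair (trans (⊗-projʳ x _) (⊗-projˡ y z))
                            (⊗-monoʳ x (⊗-projʳ y z))

module SpacetimeFacts {c ℓ₁ ℓ₂} (S : NCSpacetime c ℓ₁ ℓ₂) where
  open NCSpacetime S
  open QuantaleFacts quantale
  open ≤-Reasoning poset

  -- ∇ preserves joins, hence is monotone.
  ∇-mono : ∀ {x y} → x ≤ y → ∇ x ≤ ∇ y
  ∇-mono {x} {y} x≤y = begin
    ∇ x                         ≤⟨ ⋁-upper (∇ ∘ ⟨ x , y ⟩) (lift true) ⟩
    ⋁ (λ i → ∇ (⟨ x , y ⟩ i))   ≈⟨ ∇-⋁ ⟨ x , y ⟩ ⟨
    ∇ (⋁ ⟨ x , y ⟩)             ≈⟨ ∇-cong (⋁⟨,⟩-absorb x≤y) ⟩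
    ∇ y                         ∎

  ∇-prod-oplax : ∀ {a} {X : Set a} (f : X → Carrier) Γ → ∇ (prod f Γ) ≤ prod (∇ ∘ f) Γ
  ∇-prod-oplax f []      = ∇-e
  ∇-prod-oplax f (x ∷ Γ) = trans (∇-⊗ (f x) (prod f Γ)) (⊗-monoʳ (∇ (f x)) (∇-prod-oplax f Γ))

  StrongMonoidal : Set (c ⊔ ℓ₁)
  StrongMonoidal = (∇ e ≈ e) × (∀ x y → ∇ (x ⊗ y) ≈ ∇ x ⊗ ∇ y)

  ∇-prod-strong : StrongMonoidal → ∀ {a} {X : Set a} (f : X → Carrier) Γ →
                  prod (∇ ∘ f) Γ ≤ ∇ (prod f Γ)
  ∇-prod-strong (∇e , ∇⊗) f []      = reflexive (Eq.sym ∇e)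
  ∇-prod-strong (∇e , ∇⊗) f (x ∷ Γ) =
    trans (⊗-monoʳ (∇ (f x)) (∇-prod-strong (∇e , ∇⊗) f Γ)) (reflexive (Eq.sym (∇⊗ _ _)))

  -- _⇨_ is right adjoint to x ⊗ ∇(-): its unit (introduction) ...
  ⇨-intro : ∀ {x y z} → x ⊗ ∇ y ≤ z → y ≤ x ⇨ z
  ⇨-intro {y = y} x∇y≤z = ⋁-upper _ (lift (y , x∇y≤z))

  -- ... and its counit (modus ponens), which uses that ∇ and x ⊗ - preserve joins.
  ⇨-elim : ∀ x z → x ⊗ ∇ (x ⇨ z) ≤ z
  ⇨-elim x z = begin
    x ⊗ ∇ (x ⇨ z)            ≈⟨ ⊗-cong Eq.refl (∇-⋁ _) ⟩
    x ⊗ ⋁ (λ i → ∇ (sol i))  ≈⟨ ⋁-distribˡ x _ ⟩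
    ⋁ (λ i → x ⊗ ∇ (sol i))  ≤⟨ ⋁-least _ (λ { (lift (_ , x∇y≤z)) → x∇y≤z }) ⟩
    z                        ∎
    where
      sol : Lift ℓ₁ (Σ' Carrier (λ y → x ⊗ ∇ y ≤ z)) → Carrier
      sol (lift (y , _)) = y

module Soundness {c ℓ₁ ℓ₂} (R : Scheme → Bool) (st : Bool) (S : NCSpacetime c ℓ₁ ℓ₂)
                 (conds : InST R S) (locale : T st → IsLocale (NCSpacetime.quantale S)) where
  open NCSpacetime S
  open QuantaleFacts quantale
  open SpacetimeFacts S
  open ≤-Reasoning poset

  module _ (V : ℕ → Carrier) where

    ⟦_⟧' : Fm → Carrier
    ⟦ A ⟧' = ⟦_⟧ S A V

    open ListProduct ⟦_⟧'

    ⟪_⟫ : Ctx → Carrier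
    ⟪_⟫ = prod ⟦_⟧'

    ⟪∇Ctx⟫ : ∀ Γ → ⟪ ∇Ctx Γ ⟫ ≡ prod (∇ ∘ ⟦_⟧') Γ
    ⟪∇Ctx⟫ = prod-map ⟦_⟧' ∇'

    ∇⟪⟫≤⟪∇Ctx⟫ : ∀ Γ → ∇ ⟪ Γ ⟫ ≤ ⟪ ∇Ctx Γ ⟫
    ∇⟪⟫≤⟪∇Ctx⟫ Γ = begin
      ∇ ⟪ Γ ⟫               ≤⟨ ∇-prod-oplax ⟦_⟧' Γ ⟩
      prod (∇ ∘ ⟦_⟧') Γ     ≡⟨ ⟪∇Ctx⟫ Γ ⟨
      ⟪ ∇Ctx Γ ⟫            ∎

    ⟪∇Ctx⟫≤∇⟪⟫ : StrongMonoidal → ∀ Γ → ⟪ ∇Ctx Γ ⟫ ≤ ∇ ⟪ Γ ⟫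
    ⟪∇Ctx⟫≤∇⟪⟫ strong Γ = begin
      ⟪ ∇Ctx Γ ⟫            ≡⟨ ⟪∇Ctx⟫ Γ ⟩
      prod (∇ ∘ ⟦_⟧') Γ     ≤⟨ ∇-prod-strong strong ⟦_⟧' Γ ⟩
      ∇ ⟪ Γ ⟫               ∎

    -- Semantic content of rule H: under condition H the context
    -- ∇Γ, ∇A₁ → ∇B₁, …, ∇Aₙ → ∇Bₙ  lies below  ∇(Γ, A₁ → B₁, …, Aₙ → Bₙ),
    -- since ∇ is strong monoidal and commutes with _⇨_.
    ⟪∇H⟫ : Cond S H → ∀ Γ ps → ⟪ ∇Ctx Γ ++ ∇imps ps ⟫ ≤ ∇ ⟪ Γ ++ imps ps ⟫
    ⟪∇H⟫ (lift (∇e , ∇⊗ , _ , _ , ∇⇨)) Γ ps = begin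
      ⟪ ∇Ctx Γ ++ ∇imps ps ⟫       ≈⟨ prod-++ (∇Ctx Γ) (∇imps ps) ⟩
      ⟪ ∇Ctx Γ ⟫ ⊗ ⟪ ∇imps ps ⟫    ≤⟨ ⊗-mono (⟪∇Ctx⟫≤∇⟪⟫ (∇e , ∇⊗) Γ) (⟪∇imps⟫ ps) ⟩
      ∇ ⟪ Γ ⟫ ⊗ ∇ ⟪ imps ps ⟫      ≈⟨ ∇⊗ _ _ ⟨
      ∇ (⟪ Γ ⟫ ⊗ ⟪ imps ps ⟫)      ≈⟨ ∇-cong (prod-++ Γ (imps ps)) ⟨
      ∇ ⟪ Γ ++ imps ps ⟫           ∎
      where
        ⟪∇imps⟫ : ∀ ps → ⟪ ∇imps ps ⟫ ≤ ∇ ⟪ imps ps ⟫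
        ⟪∇imps⟫ []             = reflexive (Eq.sym ∇e)
        ⟪∇imps⟫ ((A , B) ∷ ps) =
          trans (⊗-mono (reflexive (Eq.sym (∇⇨ ⟦ A ⟧' ⟦ B ⟧'))) (⟪∇imps⟫ ps))
                (reflexive (Eq.sym (∇⊗ _ _)))

    sound : ∀ {Γ A} → Der R st Γ A → ⟪ Γ ⟫ ≤ ⟦ A ⟧'
    sound (ax A)       = reflexive prod-[ A ]
    sound ax1          = refl
    sound ax∇1         = trans (reflexive prod-[ ∇' 𝟙' ]) ∇-e
    sound (ax⊤ Γ)      = top-max ⟪ Γ ⟫
    sound (ax⊥ Γ Σ A)  = trans (bot-in-context Γ Σ refl) (bot-min ⟦ A ⟧')
    sound (cut {Γ} {Π} {Σ} {A} d₁ d₂) =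
      trans (replace Π Γ (A ∷ []) Σ (≤-singleton A (sound d₁))) (sound d₂)
    sound (L∧₁ {Γ} {Σ} d) = trans (replace₁ Γ Σ (∧-lb₁ _ _)) (sound d)
    sound (L∧₂ {Γ} {Σ} d) = trans (replace₁ Γ Σ (∧-lb₂ _ _)) (sound d)
    sound (R∧ d₁ d₂)   = ∧-glb (sound d₁) (sound d₂)
    sound (L∨ {Γ} {Σ} {A} {B} d₁ d₂) = begin
      ⟪ Γ ++ A ∨' B ∷ Σ ⟫                                           ≈⟨ prod-++ Γ _ ⟩
      ⟪ Γ ⟫ ⊗ ((⟦ A ⟧' ∨ ⟦ B ⟧') ⊗ ⟪ Σ ⟫)                           ≤⟨ ⊗-distrib-∨ _ _ _ _ ⟩
      (⟪ Γ ⟫ ⊗ (⟦ A ⟧' ⊗ ⟪ Σ ⟫)) ∨ (⟪ Γ ⟫ ⊗ (⟦ B ⟧' ⊗ ⟪ Σ ⟫))      ≤⟨ ∨-lub (premise d₁) (premise d₂) ⟩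
      _                                                             ∎
      where
        premise : ∀ {D C} → Der R st (Γ ++ D ∷ Σ) C → ⟪ Γ ⟫ ⊗ (⟦ D ⟧' ⊗ ⟪ Σ ⟫) ≤ ⟦ C ⟧'
        premise {D} d = trans (reflexive (Eq.sym (prod-++ Γ (D ∷ Σ)))) (sound d)
    sound (R∨₁ d)      = trans (sound d) (∨-ub₁ _ _)
    sound (R∨₂ d)      = trans (sound d) (∨-ub₂ _ _)
    sound (L1 {Γ} {Σ} d) =
      trans (replace Γ (𝟙' ∷ []) [] Σ (reflexive (⊗-identityʳ e))) (sound d)
    sound (L⊗ {Γ} {Σ} {A} {B} d) =
      trans (replace Γ (A ⊗' B ∷ []) (A ∷ B ∷ []) Σ (reflexive (⊗-assoc _ _ e))) (sound d)
    sound (R⊗ {Γ} {Σ} d₁ d₂) = trans (reflexive (prod-++ Γ Σ)) (⊗-mono (sound d₁) (sound d₂))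
    sound (r∇ {A} d)   = trans (reflexive prod-[ ∇' A ]) (∇-mono (singleton-≤ A (sound d)))
    sound (oplax {A} {B} d) = begin
      ⟪ ∇' (A ⊗' B) ∷ [] ⟫          ≈⟨ prod-[ ∇' (A ⊗' B) ] ⟩
      ∇ (⟦ A ⟧' ⊗ ⟦ B ⟧')           ≤⟨ ∇-⊗ _ _ ⟩
      ∇ ⟦ A ⟧' ⊗ ∇ ⟦ B ⟧'           ≈⟨ ⊗-cong Eq.refl (prod-[ ∇' B ]) ⟨
      ⟪ ∇' A ∷ ∇' B ∷ [] ⟫          ≤⟨ sound d ⟩
      _                             ∎
    -- Γ is first cut against A, then  A , ∇(A → B)  is replaced by B.
    sound (L⇒ {Γ} {Π} {Σ} {A} {B} d₁ d₂) = begin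
      ⟪ Π ++ Γ ++ ∇' (A ⇒' B) ∷ Σ ⟫  ≤⟨ replace Π Γ (A ∷ []) _ (≤-singleton A (sound d₁)) ⟩
      ⟪ Π ++ A ∷ ∇' (A ⇒' B) ∷ Σ ⟫   ≤⟨ replace Π (A ∷ ∇' (A ⇒' B) ∷ []) (B ∷ []) Σ modusPonens ⟩
      ⟪ Π ++ B ∷ Σ ⟫                 ≤⟨ sound d₂ ⟩
      _                              ∎
      where
        modusPonens : ⟦ A ⟧' ⊗ (∇ (⟦ A ⟧' ⇨ ⟦ B ⟧') ⊗ e) ≤ ⟦ B ⟧' ⊗ e
        modusPonens = trans (reflexive (Eq.sym (⊗-assoc _ _ e))) (⊗-monoˡ e (⇨-elim _ _))
    sound (R⇒ {Γ} {A} d) =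
      ⇨-intro (trans (⊗-monoʳ ⟦ A ⟧' (∇⟪⟫≤⟪∇Ctx⟫ Γ)) (sound d))
    sound (rN t {Γ} d) = trans (⟪∇Ctx⟫≤∇⟪⟫ (lower (conds N t)) Γ) (∇-mono (sound d))
    sound (rP t d)     = trans (sound d) (lower (conds P t) _)
    sound (rF t d)     = trans (sound d) (lower (conds F t) _)
    sound (rwF t {A} d) =
      reflexive (Eq.trans (prod-[ A ]) (lower (conds wF t) ⟦ A ⟧' ∇A≈bot))
      where
        ∇A≈bot : ∇ ⟦ A ⟧' ≈ bot
        ∇A≈bot = antisym (singleton-≤ (∇' A) (sound d)) (bot-min _)
    sound (rH t {Γ} {ps} d) = trans (⟪∇H⟫ (conds H t) Γ ps) (∇-mono (sound d))
    sound (wk t {Γ} {Σ} {A} d) =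
      trans (replace Γ (A ∷ []) [] Σ (⊗-projʳ _ e)) (sound d)
      where open LocaleFacts quantale (locale t)
    sound (ctr t {Γ} {Σ} {A} d) =
      trans (replace Γ (A ∷ []) (A ∷ A ∷ []) Σ (⊗-contract _ e)) (sound d)
      where open LocaleFacts quantale (locale t)
    sound (exch t {Γ} {Σ} {A} {B} d) =
      trans (replace Γ (B ∷ A ∷ []) (A ∷ B ∷ []) Σ (⊗-exchange _ _ e)) (sound d)
      where open LocaleFacts quantale (locale t)

    -- The context semantics ⟦_⟧ctx (no trailing e) lies below ⟪_⟫.
    ⟦⟧ctx≤⟪⟫ : ∀ Γ → ⟦_⟧ctx S Γ V ≤ ⟪ Γ ⟫
    ⟦⟧ctx≤⟪⟫ []          = refl
    ⟦⟧ctx≤⟪⟫ (A ∷ [])    = ≤-singleton A refl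
    ⟦⟧ctx≤⟪⟫ (A ∷ B ∷ Γ) = ⊗-monoʳ ⟦ A ⟧' (⟦⟧ctx≤⟪⟫ (B ∷ Γ))

  valid : ∀ {Γ A} → Der R st Γ A → Valid S Γ A
  valid {Γ} d V = trans (⟦⟧ctx≤⟪⟫ V Γ) (sound V d)

theorem7p10 : ∀ {c ℓ₁ ℓ₂ : Level} (R : Scheme → Bool) →
    (∀ Γ A → STL⊢ R Γ A →
      ∀ (S : NCSpacetime c ℓ₁ ℓ₂) → InST R S → Valid S Γ A)
    ×
    (∀ Γ A → iSTL⊢ R Γ A →
      ∀ (S : NCSpacetime c ℓ₁ ℓ₂) → IniST R S → Valid S Γ A)
theorem7p10 {c} {ℓ₁} {ℓ₂} R = withoutStructural , withStructural
  where
    withoutStructural : ∀ Γ A → STL⊢ R Γ A → ∀ (S : NCSpacetime c ℓ₁ ℓ₂) → InST R S → Valid S Γ A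
    withoutStructural Γ A d S conds = Soundness.valid R false S conds (λ ()) d

    withStructural : ∀ Γ A → iSTL⊢ R Γ A → ∀ (S : NCSpacetime c ℓ₁ ℓ₂) → IniST R S → Valid S Γ A
    withStructural Γ A d S (isLocale , conds) = Soundness.valid R true S conds (λ _ → isLocale) d
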